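{- Let $\mathcal{B}$ be a finite subgroup of $\mathrm{SL}(2,\mathbb{C})$ that is closed under negation and under matrix transposition, and let $\mathcal{G}=\{\{B,-B\}:B\in\mathcal{B}\}$ be the quotient group, with transpose map $\varphi(\{B,-B\})=\{B^T,-B^T\}$. Suppose $\mathcal{G}$ is isomorphic to the Klein four-group $K_4$, to the alternating group $A_4$, to the symmetric group $S_4$, or to the alternating group $A_5$. Then there exists a subgroup $K\le\mathcal{G}$ isomorphic to $K_4$ with $\varphi(K)=K$.
   Context: $\varphi$ is a bijection of $\mathcal{G}$ with $\varphi\circ\varphi=\mathrm{id}$ and $\varphi(gh)=\varphi(h)\varphi(g)$ (an involutive anti-automorphism). These four groups are exactly the finite subgroups of $\mathrm{SO}(3)$ containing a $K_4$ subgroup other than the dihedral groups $D_{2n}$ with $n>2$ even. -}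

module Defs where

open import Level using (Level; _⊔_; 0ℓ) renaming (suc to lsuc)
open import Algebra.Bundles using (CommutativeRing)
open import Data.Bool using (Bool; true; false; _∧_; _xor_)
open import Data.Nat using (ℕ; _<ᵇ_; _%_)
open import Data.Fin using (Fin; toℕ)
open import Data.Vec using (Vec; lookup; tabulate)
open import Data.List using (List; length; filterᵇ; cartesianProduct; allFin)
open import Data.List.Relation.Unary.Any using (Any)
open import Data.List.Relation.Unary.All using (All)
open import Data.Product using (Σ; _×_; _,_; ∃)
open import Data.Sum using (_⊎_)
open import Data.Unit using (⊤)
open import Relation.Binary.PropositionalEquality using (_≡_)

record ConcreteGroup : Set₁ where
  field
    Elt : Set
    _·_ : Elt → Elt → Elt
    Mem : Elt → Set

Perm : ℕ → Set
Perm n = Vec (Fin n) n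

_∘ₚ_ : ∀ {n} → Perm n → Perm n → Perm n
σ ∘ₚ τ = tabulate (λ i → lookup σ (lookup τ i))

IsPerm : ∀ {n} → Perm n → Set
IsPerm σ = ∀ i j → lookup σ i ≡ lookup σ j → i ≡ j

inversions : ∀ {n} → Perm n → ℕ
inversions {n} σ = length (filterᵇ isInv (cartesianProduct (allFin n) (allFin n)))
  where
  isInv : Fin n × Fin n → Bool
  isInv (i , j) = (toℕ i <ᵇ toℕ j) ∧ (toℕ (lookup σ j) <ᵇ toℕ (lookup σ i))

IsEvenPerm : ∀ {n} → Perm n → Set
IsEvenPerm σ = IsPerm σ × (inversions σ % 2 ≡ 0)

K4 : ConcreteGroup
K4 = record { Elt = Bool × Bool
            ; _·_ = λ { (a , b) (c , d) → (a xor c , b xor d) }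
            ; Mem = λ _ → ⊤ }

S4 : ConcreteGroup
S4 = record { Elt = Perm 4 ; _·_ = _∘ₚ_ ; Mem = IsPerm }

A4 : ConcreteGroup
A4 = record { Elt = Perm 4 ; _·_ = _∘ₚ_ ; Mem = IsEvenPerm }

A5 : ConcreteGroup
A5 = record { Elt = Perm 5 ; _·_ = _∘ₚ_ ; Mem = IsEvenPerm }

module Matrices {c ℓ : Level} (R : CommutativeRing c ℓ) where
  open CommutativeRing R

  record M2 : Set c where
    constructor mat
    field a b c' d : Carrier   -- the matrix [[a , b] , [c' , d]]
  open M2 public

  _≈M_ : M2 → M2 → Set ℓ
  M ≈M N = (a M ≈ a N) × (b M ≈ b N) × (c' M ≈ c' N) × (d M ≈ d N)

  _⊗_ : M2 → M2 → M2
  M ⊗ N = mat (a M * a N + b M * c' N) (a M * b N + b M * d N)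
              (c' M * a N + d M * c' N) (c' M * b N + d M * d N)

  I₂ : M2
  I₂ = mat 1# 0# 0# 1#

  neg : M2 → M2
  neg M = mat (- a M) (- b M) (- c' M) (- d M)

  transpose : M2 → M2
  transpose M = mat (a M) (c' M) (b M) (d M)

  det : M2 → Carrier
  det M = a M * d M - b M * c' M

  -- inverse of a determinant-one matrix
  adj : M2 → M2
  adj M = mat (d M) (- b M) (- c' M) (a M)

  _∈L_ : M2 → List M2 → Set (c ⊔ ℓ)
  M ∈L Bs = Any (λ N → M ≈M N) Bs

  record IsFiniteSubgroupSL2 (Bs : List M2) : Set (c ⊔ ℓ) where
    field
      det-one : All (λ M → det M ≈ 1#) Bs
      has-id  : I₂ ∈L Bs
      mul-closed : ∀ M N → M ∈L Bs → N ∈L Bs → (M ⊗ N) ∈L Bs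
      inv-closed : ∀ M → M ∈L Bs → adj M ∈L Bs

  ClosedUnderNeg : List M2 → Set (c ⊔ ℓ)
  ClosedUnderNeg Bs = ∀ M → M ∈L Bs → neg M ∈L Bs

  ClosedUnderTranspose : List M2 → Set (c ⊔ ℓ)
  ClosedUnderTranspose Bs = ∀ M → M ∈L Bs → transpose M ∈L Bs

  -- M and N represent the same element {B , -B} of 𝓖
  _~_ : M2 → M2 → Set ℓ
  M ~ N = (M ≈M N) ⊎ (M ≈M neg N)

  record QuotientIso (Bs : List M2) (H : ConcreteGroup) : Set (c ⊔ ℓ) where
    open ConcreteGroup H
    field
      f      : (M : M2) → M ∈L Bs → Elt
      f-mem  : ∀ M p → Mem (f M p)
      f-resp : ∀ M N p q → M ~ N → f M p ≡ f N q
      f-hom  : ∀ M N p q r → f (M ⊗ N) r ≡ (f M p · f N q)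
      f-inj  : ∀ M N p q → f M p ≡ f N q → M ~ N
      f-surj : ∀ h → Mem h → Σ M2 λ M → Σ (M ∈L Bs) λ p → f M p ≡ h

  -- a subgroup K ≤ 𝓖 together with an isomorphism K₄ ≅ K (K = image of k),
  -- such that φ(K) = K where φ{B,-B} = {Bᵀ,-Bᵀ}
  record TransposeStableK4 (Bs : List M2) : Set (c ⊔ ℓ) where
    open ConcreteGroup K4
    field
      k      : Elt → M2
      k-mem  : ∀ h → k h ∈L Bs
      k-hom  : ∀ h h' → k (h · h') ~ (k h ⊗ k h')
      k-inj  : ∀ h h' → k h ~ k h' → h ≡ h'
      φK⊆K   : ∀ h → Σ Elt λ h' → transpose (k h) ~ k h'
      K⊆φK   : ∀ h' → Σ Elt λ h → k h' ~ transpose (k h)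

-- Transposition induces an involutive anti-automorphism φ of 𝓖, so φ maps
-- involutions to involutions, squares to squares and commuting pairs to commuting
-- pairs.  For K₄ take 𝓖 itself.  In A₄ the Klein subgroup V₄ is the set of x with
-- x² = 1, and in S₄ the set of such x that are squares, so in both cases it is
-- φ-stable.  In A₅ the fifteen involutions fall into five Klein subgroups (one
-- fixing each point), and two non-trivial involutions commute only inside one of
-- them; hence φ permutes these five subgroups, by an involution because φ ∘ φ = id,
-- and an involution of a five-element set has a fixed point.
module Submission where

open import Defs
open import Algebra.Bundles using (CommutativeRing)
open import Data.Bool using (Bool; true; false)
open import Data.Bool.Properties using (xor-comm) renaming (_≟_ to _≟ᵇ_)
open import Data.Fin using (Fin; punchIn; punchOut; #_)
open import Data.Fin.Properties using (all?; any?) renaming (_≟_ to _≟ᶠ_)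
open import Data.List using (List)
open import Data.Nat using (suc; _%_)
open import Data.Nat.Properties using () renaming (_≟_ to _≟ⁿ_)
open import Data.Product using (∃; ∃₂; _×_; _,_; proj₁; proj₂; uncurry)
open import Data.Product.Properties using () renaming (≡-dec to ×-≡-dec)
open import Data.Sum using (_⊎_; inj₁; inj₂; [_,_])
open import Data.Unit using (tt)
open import Data.Vec using (Vec; []; _∷_; lookup; tabulate; allFin)
open import Data.Vec.Properties using (lookup∘tabulate; tabulate∘lookup; tabulate-cong)
  renaming (≡-dec to Vec-≡-dec)
open import Function using (_∘_)
open import Relation.Binary.Definitions using (DecidableEquality)
open import Relation.Binary.PropositionalEquality
  using (_≡_; _≢_; refl; sym; trans; cong; cong₂; subst; module ≡-Reasoning)
open import Relation.Nullary using (Dec; yes; no)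
open import Relation.Nullary.Decidable using (map′; _×-dec_; _⊎-dec_; _→-dec_; ¬?; from-yes)
open import Relation.Unary using (Pred; Decidable)

open ≡-Reasoning

Klein : Set
Klein = ConcreteGroup.Elt K4

infixl 6 _⊕_
_⊕_ : Klein → Klein → Klein
_⊕_ = ConcreteGroup._·_ K4

ε : Klein
ε = false , false

⊕-comm : ∀ x y → x ⊕ y ≡ y ⊕ x
⊕-comm (a , b) (c , d) = cong₂ _,_ (xor-comm a c) (xor-comm b d)

infix 4 _≟ₖ_
_≟ₖ_ : DecidableEquality Klein
_≟ₖ_ = ×-≡-dec _≟ᵇ_ _≟ᵇ_

∀-Bool? : ∀ {p} {P : Pred Bool p} → Decidable P → Dec (∀ b → P b)
∀-Bool? P? = map′ (λ { (f , t) false → f ; (f , t) true → t }) (λ h → h false , h true)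
                  (P? false ×-dec P? true)

∃-Bool? : ∀ {p} {P : Pred Bool p} → Decidable P → Dec (∃ P)
∃-Bool? P? = map′ [ (false ,_) , (true ,_) ] (λ { (false , p) → inj₁ p ; (true , p) → inj₂ p })
                  (P? false ⊎-dec P? true)

∀-Klein? : ∀ {p} {P : Pred Klein p} → Decidable P → Dec (∀ x → P x)
∀-Klein? P? = map′ (λ h (a , b) → h a b) (λ h a b → h (a , b))
                   (∀-Bool? λ a → ∀-Bool? λ b → P? (a , b))

∃-Klein? : ∀ {p} {P : Pred Klein p} → Decidable P → Dec (∃ P)
∃-Klein? P? = map′ (λ { (a , b , p) → (a , b) , p }) (λ { ((a , b) , p) → a , b , p })
                   (∃-Bool? λ a → ∃-Bool? λ b → P? (a , b))

∀-Vec? : ∀ {m n p} {P : Pred (Vec (Fin m) n) p} → Decidable P → Dec (∀ v → P v)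
∀-Vec? {n = 0}     P? = map′ (λ { p [] → p }) (λ h → h []) (P? [])
∀-Vec? {n = suc n} P? = map′ (λ { h (x ∷ v) → h x v }) (λ h x v → h (x ∷ v))
                             (all? λ x → ∀-Vec? (P? ∘ (x ∷_)))

∃-Vec? : ∀ {m n p} {P : Pred (Vec (Fin m) n) p} → Decidable P → Dec (∃ P)
∃-Vec? {n = 0}     P? = map′ ([] ,_) (λ { ([] , p) → p }) (P? [])
∃-Vec? {n = suc n} P? = map′ (λ { (x , v , p) → x ∷ v , p }) (λ { (x ∷ v , p) → x , v , p })
                             (any? λ x → ∃-Vec? (P? ∘ (x ∷_)))

idₚ : ∀ {n} → Perm n
idₚ = allFin _

infix 4 _≟ₚ_
_≟ₚ_ : ∀ {n} → DecidableEquality (Perm n)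
_≟ₚ_ = Vec-≡-dec _≟ᶠ_

isPerm? : ∀ {n} (σ : Perm n) → Dec (IsPerm σ)
isPerm? σ = all? λ i → all? λ j → (lookup σ i ≟ᶠ lookup σ j) →-dec (i ≟ᶠ j)

isEvenPerm? : ∀ {n} (σ : Perm n) → Dec (IsEvenPerm σ)
isEvenPerm? σ = isPerm? σ ×-dec (inversions σ % 2 ≟ⁿ 0)

idempotent⇒idₚ : ∀ {n} (σ : Perm n) → IsPerm σ → σ ∘ₚ σ ≡ σ → σ ≡ idₚ
idempotent⇒idₚ σ σ-injective σσ≡σ = begin
  σ                   ≡⟨ tabulate∘lookup σ ⟨
  tabulate (lookup σ) ≡⟨ tabulate-cong fixes ⟩
  idₚ                 ∎
  where
  fixes : ∀ i → lookup σ i ≡ i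
  fixes i = σ-injective _ _ (begin
    lookup σ (lookup σ i) ≡⟨ lookup∘tabulate _ i ⟨
    lookup (σ ∘ₚ σ) i     ≡⟨ cong (λ τ → lookup τ i) σσ≡σ ⟩
    lookup σ i            ∎)

fixing : ∀ {n} → Fin (suc n) → Perm n → Perm (suc n)
fixing {n} i σ = tabulate λ k → image k (i ≟ᶠ k)
  where
  image : ∀ k → Dec (i ≡ k) → Fin (suc n)
  image k (yes _)   = i
  image k (no i≢k) = punchIn i (lookup σ (punchOut i≢k))

-- A ConcreteGroup does not assert that Mem is closed under _·_, so closure is a
-- field here.
record AntiInvolution (H : ConcreteGroup) : Set where
  open ConcreteGroup H
  field
    ·-closed     : ∀ x y → Mem x → Mem y → Mem (x · y)
    φ            : (h : Elt) → Mem h → Elt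
    φ-closed     : ∀ h p → Mem (φ h p)
    φ-irrelevant : ∀ h p q → φ h p ≡ φ h q
    φ-anti       : ∀ x y p q r → φ (x · y) r ≡ φ y q · φ x p
    φ-involutive : ∀ h p → φ (φ h p) (φ-closed h p) ≡ h

  φ-cong : ∀ {x y} p q → x ≡ y → φ x p ≡ φ y q
  φ-cong p q refl = φ-irrelevant _ p q

  φ-injective : ∀ {x y} p q → φ x p ≡ φ y q → x ≡ y
  φ-injective {x} {y} p q φx≡φy = begin
    x                        ≡⟨ φ-involutive x p ⟨
    φ (φ x p) (φ-closed x p) ≡⟨ φ-cong _ (φ-closed y q) φx≡φy ⟩
    φ (φ y q) (φ-closed y q) ≡⟨ φ-involutive y q ⟩
    y                        ∎

  φ-swap : ∀ {x y} p q → φ x p ≡ y → φ y q ≡ x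
  φ-swap {x} p q refl = trans (φ-irrelevant _ q (φ-closed x p)) (φ-involutive x p)

  φ-commute : ∀ x y p q → x · y ≡ y · x → φ x p · φ y q ≡ φ y q · φ x p
  φ-commute x y p q xy≡yx = begin
    φ x p · φ y q                ≡⟨ φ-anti y x q p (·-closed y x q p) ⟨
    φ (y · x) (·-closed y x q p) ≡⟨ φ-cong _ (·-closed x y p q) (sym xy≡yx) ⟩
    φ (x · y) (·-closed x y p q) ≡⟨ φ-anti x y p q _ ⟩
    φ y q · φ x p                ∎

  module WithIdentity (e : Elt) (e-closed : Mem e) (e·e≡e : e · e ≡ e)
                      (idempotent⇒e : ∀ y → Mem y → y · y ≡ y → y ≡ e) where

    φ-identity : φ e e-closed ≡ e
    φ-identity = idempotent⇒e _ (φ-closed e e-closed) (begin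
      φ e e-closed · φ e e-closed  ≡⟨ φ-anti e e _ _ (·-closed e e e-closed e-closed) ⟨
      φ (e · e) (·-closed e e _ _) ≡⟨ φ-cong _ e-closed e·e≡e ⟩
      φ e e-closed                 ∎)

    φ-involution : ∀ x p → x · x ≡ e → φ x p · φ x p ≡ e
    φ-involution x p x·x≡e = begin
      φ x p · φ x p                ≡⟨ φ-anti x x p p (·-closed x x p p) ⟨
      φ (x · x) (·-closed x x p p) ≡⟨ φ-cong _ e-closed x·x≡e ⟩
      φ e e-closed                 ≡⟨ φ-identity ⟩
      e                            ∎

    φ-nonidentity : ∀ x p → x ≢ e → φ x p ≢ e
    φ-nonidentity x p x≢e φx≡e = x≢e (φ-injective p e-closed (trans φx≡e (sym φ-identity)))

record KleinSubgroup (H : ConcreteGroup) : Set where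
  open ConcreteGroup H
  field
    κ           : Klein → Elt
    κ-closed    : ∀ x → Mem (κ x)
    κ-hom       : ∀ x y → κ (x ⊕ y) ≡ κ x · κ y
    κ-injective : ∀ x y → κ x ≡ κ y → x ≡ y

  κ-commute : ∀ x y → κ x · κ y ≡ κ y · κ x
  κ-commute x y = trans (sym (κ-hom x y)) (trans (cong κ (⊕-comm x y)) (κ-hom y x))

Stable : ∀ {H} → AntiInvolution H → KleinSubgroup H → Set
Stable anti K = ∀ x → ∃ λ y → AntiInvolution.φ anti (κ x) (κ-closed x) ≡ κ y
  where open KleinSubgroup K

HasStableKlein : ConcreteGroup → Set
HasStableKlein H = (anti : AntiInvolution H) → ∃ (Stable anti)

module _ {H : ConcreteGroup} (anti : AntiInvolution H) (K : KleinSubgroup H) where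
  open ConcreteGroup H
  open AntiInvolution anti
  open KleinSubgroup K

  invariant-characterisation⇒stable : (P : Elt → Set) → (∀ x → P (κ x)) →
    (∀ y → Mem y → P y → ∃ λ x → y ≡ κ x) → (∀ y p → P y → P (φ y p)) → Stable anti K
  invariant-characterisation⇒stable P P-κ P⇒κ φ-preserves-P x =
    P⇒κ _ (φ-closed _ _) (φ-preserves-P _ _ (P-κ x))

K₄-hasStableKlein : HasStableKlein K4
K₄-hasStableKlein anti = whole , λ x → φ x tt , refl
  where
  open AntiInvolution anti
  whole : KleinSubgroup K4
  whole = record { κ = λ x → x ; κ-closed = λ _ → tt ; κ-hom = λ _ _ → refl ; κ-injective = λ _ _ e → e }

V₄ : Klein → Perm 4
V₄ (false , false) = idₚ
V₄ (true  , false) = # 1 ∷ # 0 ∷ # 3 ∷ # 2 ∷ []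
V₄ (false , true)  = # 2 ∷ # 3 ∷ # 0 ∷ # 1 ∷ []
V₄ (true  , true)  = # 3 ∷ # 2 ∷ # 1 ∷ # 0 ∷ []

-- Opaque facts are decided by exhaustive search; opacity keeps later unification
-- from unfolding their huge normalised proofs.
opaque
  V₄-even : ∀ x → IsEvenPerm (V₄ x)
  V₄-even = from-yes (∀-Klein? λ x → isEvenPerm? (V₄ x))

  V₄-hom : ∀ x y → V₄ (x ⊕ y) ≡ V₄ x ∘ₚ V₄ y
  V₄-hom = from-yes (∀-Klein? λ x → ∀-Klein? λ y → V₄ (x ⊕ y) ≟ₚ V₄ x ∘ₚ V₄ y)

  V₄-injective : ∀ x y → V₄ x ≡ V₄ y → x ≡ y
  V₄-injective = from-yes (∀-Klein? λ x → ∀-Klein? λ y → (V₄ x ≟ₚ V₄ y) →-dec (x ≟ₖ y))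

  V₄-involutive : ∀ x → V₄ x ∘ₚ V₄ x ≡ idₚ
  V₄-involutive = from-yes (∀-Klein? λ x → V₄ x ∘ₚ V₄ x ≟ₚ idₚ)

  V₄-square : ∀ x → ∃ λ τ → IsPerm τ × V₄ x ≡ τ ∘ₚ τ
  V₄-square = from-yes (∀-Klein? λ x → ∃-Vec? λ τ → isPerm? τ ×-dec (V₄ x ≟ₚ τ ∘ₚ τ))

  even-involution⇒V₄ : ∀ σ → IsEvenPerm σ → σ ∘ₚ σ ≡ idₚ → ∃ λ x → σ ≡ V₄ x
  even-involution⇒V₄ = from-yes (∀-Vec? λ σ →
    isEvenPerm? σ →-dec (σ ∘ₚ σ ≟ₚ idₚ →-dec ∃-Klein? λ x → σ ≟ₚ V₄ x))

  involutive-square⇒V₄ : ∀ τ → IsPerm τ → (τ ∘ₚ τ) ∘ₚ (τ ∘ₚ τ) ≡ idₚ → ∃ λ x → τ ∘ₚ τ ≡ V₄ x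
  involutive-square⇒V₄ = from-yes (∀-Vec? λ τ →
    isPerm? τ →-dec ((τ ∘ₚ τ) ∘ₚ (τ ∘ₚ τ) ≟ₚ idₚ →-dec ∃-Klein? λ x → τ ∘ₚ τ ≟ₚ V₄ x))

A₄-hasStableKlein : HasStableKlein A4
A₄-hasStableKlein anti = V₄-A₄ , invariant-characterisation⇒stable anti V₄-A₄
  (λ σ → σ ∘ₚ σ ≡ idₚ) V₄-involutive even-involution⇒V₄ φ-involution
  where
  open AntiInvolution anti
  open WithIdentity idₚ (V₄-even ε) refl (λ σ p → idempotent⇒idₚ σ (proj₁ p))
  V₄-A₄ : KleinSubgroup A4
  V₄-A₄ = record { κ = V₄ ; κ-closed = V₄-even ; κ-hom = V₄-hom ; κ-injective = V₄-injective }

S₄-hasStableKlein : HasStableKlein S4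
S₄-hasStableKlein anti = V₄-S₄ , invariant-characterisation⇒stable anti V₄-S₄
  SquareInvolution (λ x → V₄-involutive x , V₄-square x) square-involution⇒V₄ φ-preserves
  where
  open AntiInvolution anti
  open WithIdentity idₚ (proj₁ (V₄-even ε)) refl idempotent⇒idₚ
  V₄-S₄ : KleinSubgroup S4
  V₄-S₄ = record { κ = V₄ ; κ-closed = proj₁ ∘ V₄-even ; κ-hom = V₄-hom ; κ-injective = V₄-injective }

  SquareInvolution : Perm 4 → Set
  SquareInvolution σ = σ ∘ₚ σ ≡ idₚ × ∃ λ τ → IsPerm τ × σ ≡ τ ∘ₚ τ

  square-involution⇒V₄ : ∀ σ → IsPerm σ → SquareInvolution σ → ∃ λ x → σ ≡ V₄ x
  square-involution⇒V₄ _ _ (σσ≡id , τ , τ-perm , refl) = involutive-square⇒V₄ τ τ-perm σσ≡id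

  φ-preserves : ∀ σ p → SquareInvolution σ → SquareInvolution (φ σ p)
  φ-preserves σ p (σσ≡id , τ , τ-perm , σ≡ττ) =
    φ-involution σ p σσ≡id , φ τ τ-perm , φ-closed τ τ-perm ,
    trans (φ-cong p (·-closed τ τ τ-perm τ-perm) σ≡ττ) (φ-anti τ τ τ-perm τ-perm _)

V₄-fixing : Fin 5 → Klein → Perm 5
V₄-fixing i = fixing i ∘ V₄

opaque
  V₄-fixing-even : ∀ i x → IsEvenPerm (V₄-fixing i x)
  V₄-fixing-even = from-yes (all? λ i → ∀-Klein? λ x → isEvenPerm? (V₄-fixing i x))

  V₄-fixing-hom : ∀ i x y → V₄-fixing i (x ⊕ y) ≡ V₄-fixing i x ∘ₚ V₄-fixing i y
  V₄-fixing-hom = from-yes (all? λ i → ∀-Klein? λ x → ∀-Klein? λ y →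
    V₄-fixing i (x ⊕ y) ≟ₚ V₄-fixing i x ∘ₚ V₄-fixing i y)

  V₄-fixing-injective : ∀ i x y → V₄-fixing i x ≡ V₄-fixing i y → x ≡ y
  V₄-fixing-injective = from-yes (all? λ i → ∀-Klein? λ x → ∀-Klein? λ y →
    (V₄-fixing i x ≟ₚ V₄-fixing i y) →-dec (x ≟ₖ y))

  V₄-fixing-involutive : ∀ i x → V₄-fixing i x ∘ₚ V₄-fixing i x ≡ idₚ
  V₄-fixing-involutive = from-yes (all? λ i → ∀-Klein? λ x → V₄-fixing i x ∘ₚ V₄-fixing i x ≟ₚ idₚ)

  V₄-fixing-ε : ∀ i → V₄-fixing i ε ≡ idₚ
  V₄-fixing-ε = from-yes (all? λ i → V₄-fixing i ε ≟ₚ idₚ)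

  even-involution⇒V₄-fixing : ∀ σ → IsEvenPerm σ → σ ∘ₚ σ ≡ idₚ → ∃₂ λ i x → σ ≡ V₄-fixing i x
  even-involution⇒V₄-fixing = from-yes (∀-Vec? λ σ →
    isEvenPerm? σ →-dec (σ ∘ₚ σ ≟ₚ idₚ →-dec any? λ i → ∃-Klein? λ x → σ ≟ₚ V₄-fixing i x))

  commuting⇒same-fixed-point : ∀ i x j y →
    V₄-fixing i x ∘ₚ V₄-fixing j y ≡ V₄-fixing j y ∘ₚ V₄-fixing i x →
    V₄-fixing i x ≢ idₚ → V₄-fixing j y ≢ idₚ → i ≡ j
  commuting⇒same-fixed-point = from-yes (all? λ i → ∀-Klein? λ x → all? λ j → ∀-Klein? λ y →
    (V₄-fixing i x ∘ₚ V₄-fixing j y ≟ₚ V₄-fixing j y ∘ₚ V₄-fixing i x) →-dec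
    (¬? (V₄-fixing i x ≟ₚ idₚ) →-dec (¬? (V₄-fixing j y ≟ₚ idₚ) →-dec (i ≟ᶠ j))))

  tabulated-involution⇒fixed-point₅ : ∀ (v : Perm 5) → (∀ i → lookup v (lookup v i) ≡ i) →
    ∃ λ i → lookup v i ≡ i
  tabulated-involution⇒fixed-point₅ = from-yes (∀-Vec? λ (v : Perm 5) →
    all? (λ i → lookup v (lookup v i) ≟ᶠ i) →-dec any? λ i → lookup v i ≟ᶠ i)

involution⇒fixed-point₅ : (σ : Fin 5 → Fin 5) → (∀ i → σ (σ i) ≡ i) → ∃ λ i → σ i ≡ i
involution⇒fixed-point₅ σ σσ≡id =
  let i , fixed = tabulated-involution⇒fixed-point₅ (tabulate σ) tabulated-involution
  in i , trans (sym (lookup∘tabulate σ i)) fixed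
  where
  tabulated-involution : ∀ i → lookup (tabulate σ) (lookup (tabulate σ) i) ≡ i
  tabulated-involution i = begin
    lookup (tabulate σ) (lookup (tabulate σ) i) ≡⟨ lookup∘tabulate σ _ ⟩
    σ (lookup (tabulate σ) i)                   ≡⟨ cong σ (lookup∘tabulate σ i) ⟩
    σ (σ i)                                     ≡⟨ σσ≡id i ⟩
    i                                           ∎

V₄-fixing-nonidentity : ∀ i x → x ≢ ε → V₄-fixing i x ≢ idₚ
V₄-fixing-nonidentity i x x≢ε Vx≡id = x≢ε (V₄-fixing-injective i x ε (trans Vx≡id (sym (V₄-fixing-ε i))))

V₄-fixing-A₅ : Fin 5 → KleinSubgroup A5
V₄-fixing-A₅ i = record
  { κ = V₄-fixing i ; κ-closed = V₄-fixing-even i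
  ; κ-hom = V₄-fixing-hom i ; κ-injective = V₄-fixing-injective i }

module A₅-argument (anti : AntiInvolution A5) where
  open AntiInvolution anti
  idₚ-even : IsEvenPerm {5} idₚ
  idₚ-even = from-yes (isEvenPerm? {5} idₚ)

  open WithIdentity idₚ idₚ-even refl (λ σ p → idempotent⇒idₚ σ (proj₁ p))

  φV : Fin 5 → Klein → Perm 5
  φV i x = φ (V₄-fixing i x) (V₄-fixing-even i x)

  φV-nonidentity : ∀ i x → x ≢ ε → φV i x ≢ idₚ
  φV-nonidentity i x x≢ε = φ-nonidentity _ _ (V₄-fixing-nonidentity i x x≢ε)

  φV-in-some-block : ∀ i x → ∃₂ λ j y → φV i x ≡ V₄-fixing j y
  φV-in-some-block i x =
    even-involution⇒V₄-fixing (φV i x) (φ-closed _ _) (φ-involution _ _ (V₄-fixing-involutive i x))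

  x₀ : Klein
  x₀ = true , false

  x₀≢ε : x₀ ≢ ε
  x₀≢ε ()

  -- φ sends the block fixing i into the block fixing σ i (φV-in-block-σ).
  σ : Fin 5 → Fin 5
  σ i = proj₁ (φV-in-some-block i x₀)

  σ-witness : ∀ i → ∃ λ y → φV i x₀ ≡ V₄-fixing (σ i) y
  σ-witness i = proj₂ (φV-in-some-block i x₀)

  φV-block≡σ : ∀ i x j y → x ≢ ε → φV i x ≡ V₄-fixing j y → j ≡ σ i
  φV-block≡σ i x j y x≢ε φVx≡ = commuting⇒same-fixed-point j y (σ i) y₀ commute
    (λ e → φV-nonidentity i x x≢ε (trans φVx≡ e))
    (λ e → φV-nonidentity i x₀ x₀≢ε (trans φVx₀≡ e))
    where
    y₀ = proj₁ (σ-witness i)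
    φVx₀≡ = proj₂ (σ-witness i)
    commute : V₄-fixing j y ∘ₚ V₄-fixing (σ i) y₀ ≡ V₄-fixing (σ i) y₀ ∘ₚ V₄-fixing j y
    commute = begin
      V₄-fixing j y ∘ₚ V₄-fixing (σ i) y₀ ≡⟨ cong₂ _∘ₚ_ φVx≡ φVx₀≡ ⟨
      φV i x ∘ₚ φV i x₀                   ≡⟨ φ-commute _ _ _ _ (KleinSubgroup.κ-commute (V₄-fixing-A₅ i) x x₀) ⟩
      φV i x₀ ∘ₚ φV i x                   ≡⟨ cong₂ _∘ₚ_ φVx₀≡ φVx≡ ⟩
      V₄-fixing (σ i) y₀ ∘ₚ V₄-fixing j y ∎

  φV-in-block-σ-nonidentity : ∀ i x → x ≢ ε → ∃ λ y → φV i x ≡ V₄-fixing (σ i) y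
  φV-in-block-σ-nonidentity i x x≢ε =
    let j , y , φVx≡ = φV-in-some-block i x
    in y , subst (λ k → φV i x ≡ V₄-fixing k y) (φV-block≡σ i x j y x≢ε φVx≡) φVx≡

  φV-in-block-σ : ∀ i x → ∃ λ y → φV i x ≡ V₄-fixing (σ i) y
  φV-in-block-σ i (false , false) = ε , (begin
    φV i ε            ≡⟨ φ-cong (V₄-fixing-even i ε) idₚ-even (V₄-fixing-ε i) ⟩
    φ idₚ idₚ-even    ≡⟨ φ-identity ⟩
    idₚ               ≡⟨ V₄-fixing-ε (σ i) ⟨
    V₄-fixing (σ i) ε ∎)
  φV-in-block-σ i x@(true , _)     = φV-in-block-σ-nonidentity i x (λ ())
  φV-in-block-σ i x@(false , true) = φV-in-block-σ-nonidentity i x (λ ())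

  -- V₄-fixing i x₀ = φ (φV i x₀) lies in the block fixing σ (σ i), and no
  -- non-identity element lies in two blocks.
  σ-involutive : ∀ i → σ (σ i) ≡ i
  σ-involutive i = sym (commuting⇒same-fixed-point i x₀ (σ (σ i)) z
    (cong₂ _∘ₚ_ Vx₀≡Vz (sym Vx₀≡Vz)) Vx₀≢id (λ e → Vx₀≢id (trans Vx₀≡Vz e)))
    where
    y₀ = proj₁ (σ-witness i)
    z = proj₁ (φV-in-block-σ (σ i) y₀)
    Vx₀≡Vz : V₄-fixing i x₀ ≡ V₄-fixing (σ (σ i)) z
    Vx₀≡Vz = trans (sym (φ-swap (V₄-fixing-even i x₀) (V₄-fixing-even (σ i) y₀) (proj₂ (σ-witness i))))
                   (proj₂ (φV-in-block-σ (σ i) y₀))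
    Vx₀≢id : V₄-fixing i x₀ ≢ idₚ
    Vx₀≢id = V₄-fixing-nonidentity i x₀ x₀≢ε

  stable : ∃ (Stable anti)
  stable = let i , σi≡i = involution⇒fixed-point₅ σ σ-involutive
           in V₄-fixing-A₅ i , λ x → subst (λ k → ∃ λ y → φV i x ≡ V₄-fixing k y) σi≡i (φV-in-block-σ i x)

A₅-hasStableKlein : HasStableKlein A5
A₅-hasStableKlein = A₅-argument.stable

module TransposeOnQuotient {c ℓ} (R : CommutativeRing c ℓ) where
  open Matrices R
  open CommutativeRing R using (_≈_; _+_; _*_; +-cong; *-comm)

  transpose-⊗ : ∀ M N → transpose (M ⊗ N) ≈M (transpose N ⊗ transpose M)
  transpose-⊗ M N = swap , swap , swap , swap
    where
    swap : ∀ {w x y z} → w * x + y * z ≈ x * w + z * y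
    swap = +-cong (*-comm _ _) (*-comm _ _)

  transpose-~ : ∀ {M N} → M ~ N → transpose M ~ transpose N
  transpose-~ (inj₁ (a , b , c , d)) = inj₁ (a , c , b , d)
  transpose-~ (inj₂ (a , b , c , d)) = inj₂ (a , c , b , d)

  module _ {Bs : List M2} (subgroup : IsFiniteSubgroupSL2 Bs) (closedᵀ : ClosedUnderTranspose Bs)
           {H : ConcreteGroup} (iso : QuotientIso Bs H) where
    open ConcreteGroup H
    open IsFiniteSubgroupSL2 subgroup using (mul-closed)
    open QuotientIso iso

    rep : (h : Elt) → Mem h → M2
    rep h p = proj₁ (f-surj h p)

    rep∈ : ∀ h p → rep h p ∈L Bs
    rep∈ h p = proj₁ (proj₂ (f-surj h p))

    f-rep : ∀ h p → f (rep h p) (rep∈ h p) ≡ h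
    f-rep h p = proj₂ (proj₂ (f-surj h p))

    f-rep-⊗ : ∀ x y p q → f (rep x p ⊗ rep y q) (mul-closed _ _ (rep∈ x p) (rep∈ y q)) ≡ x · y
    f-rep-⊗ x y p q = trans (f-hom _ _ (rep∈ x p) (rep∈ y q) _) (cong₂ _·_ (f-rep x p) (f-rep y q))

    φᵀ : (h : Elt) → Mem h → Elt
    φᵀ h p = f (transpose (rep h p)) (closedᵀ _ (rep∈ h p))

    φᵀ-anti : ∀ x y p q r → φᵀ (x · y) r ≡ φᵀ y q · φᵀ x p
    φᵀ-anti x y p q r = begin
      φᵀ (x · y) r                                    ≡⟨ f-resp _ _ _ (closedᵀ _ xy∈) (transpose-~ rep-xy~) ⟩
      f (transpose (rep x p ⊗ rep y q)) _             ≡⟨ f-resp _ _ _ yᵀxᵀ∈ (inj₁ (transpose-⊗ _ _)) ⟩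
      f (transpose (rep y q) ⊗ transpose (rep x p)) _ ≡⟨ f-hom _ _ _ _ yᵀxᵀ∈ ⟩
      φᵀ y q · φᵀ x p                                 ∎
      where
      xy∈ = mul-closed _ _ (rep∈ x p) (rep∈ y q)
      yᵀxᵀ∈ = mul-closed _ _ (closedᵀ _ (rep∈ y q)) (closedᵀ _ (rep∈ x p))
      rep-xy~ : rep (x · y) r ~ (rep x p ⊗ rep y q)
      rep-xy~ = f-inj _ _ _ _ (trans (f-rep _ r) (sym (f-rep-⊗ x y p q)))

    -- φ-involutive, and K⊆φK below, rely on transpose (transpose M) being M by η.
    transposeAnti : AntiInvolution H
    transposeAnti = record
      { ·-closed     = λ x y p q → subst Mem (f-rep-⊗ x y p q) (f-mem _ _)
      ; φ            = φᵀ
      ; φ-closed     = λ _ _ → f-mem _ _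
      ; φ-irrelevant = λ h p q →
          f-resp _ _ _ _ (transpose-~ (f-inj _ _ _ _ (trans (f-rep h p) (sym (f-rep h q)))))
      ; φ-anti       = φᵀ-anti
      ; φ-involutive = λ h p → trans (f-resp _ _ _ _ (transpose-~ (f-inj _ _ _ _ (f-rep _ _)))) (f-rep h p)
      }

    transposeStableK4 : (K : KleinSubgroup H) → Stable transposeAnti K → TransposeStableK4 Bs
    transposeStableK4 K stable = record
      { k      = k
      ; k-mem  = k∈
      ; k-hom  = λ x y → f-inj _ _ _ _ (trans (f-rep _ _) (trans (κ-hom x y) (sym (f-rep-⊗ _ _ _ _))))
      ; k-inj  = λ x y kx~ky →
          κ-injective x y (trans (sym (f-rep _ _)) (trans (f-resp _ _ _ _ kx~ky) (f-rep _ _)))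
      ; φK⊆K   = φK⊆K
      ; K⊆φK   = λ x → proj₁ (φK⊆K x) , transpose-~ (proj₂ (φK⊆K x))
      }
      where
      open KleinSubgroup K
      k : Klein → M2
      k x = rep (κ x) (κ-closed x)
      k∈ : ∀ x → k x ∈L Bs
      k∈ x = rep∈ (κ x) (κ-closed x)
      φK⊆K : ∀ x → ∃ λ y → transpose (k x) ~ k y
      φK⊆K x = proj₁ (stable x) , f-inj _ _ _ (k∈ _) (trans (proj₂ (stable x)) (sym (f-rep _ _)))

mainTheorem6 : ∀ {c ℓ} (R : CommutativeRing c ℓ) → let open Matrices R in
    (Bs : List M2) → IsFiniteSubgroupSL2 Bs → ClosedUnderNeg Bs → ClosedUnderTranspose Bs →
    QuotientIso Bs K4 ⊎ QuotientIso Bs A4 ⊎ QuotientIso Bs S4 ⊎ QuotientIso Bs A5 →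
    TransposeStableK4 Bs
mainTheorem6 R Bs subgroup _ closedᵀ =
  [ stable K₄-hasStableKlein ,
  [ stable A₄-hasStableKlein ,
  [ stable S₄-hasStableKlein , stable A₅-hasStableKlein ] ] ]
  where
  open Matrices R using (QuotientIso; TransposeStableK4)
  open TransposeOnQuotient R using (transposeAnti; transposeStableK4)
  stable : ∀ {H} → HasStableKlein H → QuotientIso Bs H → TransposeStableK4 Bs
  stable hasStable iso =
    uncurry (transposeStableK4 subgroup closedᵀ iso) (hasStable (transposeAnti subgroup closedᵀ iso))
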